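{- Let $G$ be a finite graph with $|V(G)|\ge 2$. If $\omega_M(G)\geq 2$, then $$\omega_M(G)=\max\{|C|:C\in\mathfrak{S}(G),\ |C|\geq 2,\ \lambda_G(C^{\uparrow})=\blacksquare\},$$ and if $\alpha_M(G)\geq 2$, then $$\alpha_M(G)=\max\{|C|:C\in\mathfrak{S}(G),\ |C|\geq 2,\ \lambda_G(C^{\uparrow})=\square\}.$$
   Context: Graphs are finite, simple, undirected. A module of $G$ is a set $M\subseteq V(G)$ such that each vertex outside $M$ is adjacent to all or none of $M$; trivial modules are $\emptyset$, $V(G)$, singletons; a graph is prime if it has at least $4$ vertices and all modules are trivial. $\omega_M(G)$ (resp. $\alpha_M(G)$) is the largest size of a module of $G$ that is a clique (resp. a stable set) in $G$. A module $M$ is strong if for every module $N$ with $M\cap N\neq\emptyset$, $M\subseteq N$ or $N\subseteq M$; $\mathbb{S}(G)$ is the family of nonempty strong modules. For a graph $H$ with $|V(H)|\ge 2$, $\Pi(H)$ is the family of maximal proper nonempty strong modules of $H$; by Gallai's theorem it partitions $V(H)$ into modules, distinct parts are completely adjacent or completely non-adjacent, and the quotient $H/\Pi(H)$ (vertices the parts, adjacency inherited) is complete, empty or prime. For $M\in\mathbb{S}(G)$ with $|M|\ge 2$, $\lambda_G(M)=\blacksquare$, $\square$, $\sqcup$ according as $G[M]/\Pi(G[M])$ is complete, empty, prime. For $W\subseteq V(G)$, $W^{\uparrow}$ is the smallest strong module containing $W$; for $W\subsetneq V(G)$, $W^{\Uparrow}$ is the smallest strong module strictly containing $W$. $v\leftrightarrow_G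 w$ iff $\{v\}^{\Uparrow}=\{w\}^{\Uparrow}$, and $\mathfrak{S}(G)$ is the set of equivalence classes of $\leftrightarrow_G$. -}

module Defs where

open import Data.Nat using (ℕ; _≤_)
open import Data.Fin using (Fin)
open import Data.Fin.Subset using (Subset; _∈_; _∉_; _⊆_; ∣_∣; ⁅_⁆; ⊤; Nonempty; _∩_)
open import Data.Bool using (Bool; true; false)
open import Data.Product using (_×_; ∃-syntax; Σ-syntax)
open import Data.Sum using (_⊎_)
open import Relation.Binary.PropositionalEquality using (_≡_; _≢_)
open import Relation.Nullary using (¬_)

record Graph (n : ℕ) : Set where
  field
    adj        : Fin n → Fin n → Bool
    adj-sym    : ∀ u v → adj u v ≡ adj v u
    adj-irrefl : ∀ v → adj v v ≡ false

IsGreatest : (ℕ → Set) → ℕ → Set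
IsGreatest P k = P k × (∀ m → P m → m ≤ k)

module _ {n : ℕ} (G : Graph n) where
  open Graph G

  Adj : Fin n → Fin n → Set
  Adj u v = adj u v ≡ true

  IsModuleIn : Subset n → Subset n → Set
  IsModuleIn M N =
    N ⊆ M ×
    (∀ x → x ∈ M → x ∉ N →
       (∀ y → y ∈ N → Adj x y) ⊎ (∀ y → y ∈ N → ¬ Adj x y))

  IsModule : Subset n → Set
  IsModule N = IsModuleIn ⊤ N

  IsStrongIn : Subset n → Subset n → Set
  IsStrongIn M N =
    IsModuleIn M N ×
    (∀ N' → IsModuleIn M N' → Nonempty (N ∩ N') → N ⊆ N' ⊎ N' ⊆ N)

  IsStrong : Subset n → Set
  IsStrong N = IsStrongIn ⊤ N

  IsClique : Subset n → Set
  IsClique M = ∀ x y → x ∈ M → y ∈ M → x ≢ y → Adj x y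

  IsStable : Subset n → Set
  IsStable M = ∀ x y → x ∈ M → y ∈ M → x ≢ y → ¬ Adj x y

  IsOmegaM : ℕ → Set
  IsOmegaM = IsGreatest (λ s → ∃[ M ] (IsModule M × IsClique M × ∣ M ∣ ≡ s))

  IsAlphaM : ℕ → Set
  IsAlphaM = IsGreatest (λ s → ∃[ M ] (IsModule M × IsStable M × ∣ M ∣ ≡ s))

  IsUp : Subset n → Subset n → Set
  IsUp W M = IsStrong M × W ⊆ M × (∀ M' → IsStrong M' → W ⊆ M' → M ⊆ M')

  IsUUp : Subset n → Subset n → Set
  IsUUp W M =
    IsStrong M × W ⊆ M × W ≢ M ×
    (∀ M' → IsStrong M' → W ⊆ M' → W ≢ M' → M ⊆ M')

  Equiv : Fin n → Fin n → Set
  Equiv v w = ∃[ M ] (IsUUp ⁅ v ⁆ M × IsUUp ⁅ w ⁆ M)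

  IsClass : Subset n → Set
  IsClass C = ∃[ v ] (v ∈ C × (∀ w → (w ∈ C → Equiv v w) × (Equiv v w → w ∈ C)))

  IsPart : Subset n → Subset n → Set
  IsPart M P =
    IsStrongIn M P × Nonempty P × P ≢ M ×
    (∀ Q → IsStrongIn M Q → Nonempty Q → Q ≢ M → P ⊆ Q → Q ⊆ P)

  -- adjacency in the quotient G[M]/Π(G[M]) (inherited from G)
  QAdj : Subset n → Subset n → Set
  QAdj P Q = ∃[ x ] ∃[ y ] (x ∈ P × y ∈ Q × Adj x y)

  LabelComplete : Subset n → Set
  LabelComplete M =
    ∀ P Q → IsPart M P → IsPart M Q → P ≢ Q → QAdj P Q

  LabelEmpty : Subset n → Set
  LabelEmpty M =
    ∀ P Q → IsPart M P → IsPart M Q → P ≢ Q → ¬ QAdj P Q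

-- Call a vertex set b-monochromatic if all its pairs have adjacency b: cliques for b = true,
-- stable sets for b = false. Let K be a b-monochromatic module with vertices v ≠ w. Every pair
-- inside K is a module, so a strong module containing a vertex of K and anything else contains
-- all of K; hence {u}⇑ = {v}⇑ = U for all u ∈ K, and K lies in one class C with C↑ = U.
-- In G[U] the singleton {v} is a part while {v, w} is a module whose pair has colour b, and this
-- forces every pair between distinct parts to have colour b. Indeed, a pair of colour not b
-- between two parts cannot lie in a proper component of the graph of pairs of colour not b, since
-- such a component is a strong module and so lies inside a part; hence that graph is connected.
-- So is the graph of pairs of colour b: a proper component of v would be a proper strong module,
-- hence the part {v}, yet it contains w. But when both graphs are connected, a maximal proper
-- module containing {v, w} is strong, contradicting the maximality of {v}.
-- Conversely, if C↑ is labelled b for a class C, the singletons of C are parts of C↑, so C is a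
-- b-monochromatic module. Hence both maxima range over the same sizes.

module Submission where

open import Defs
open import Level using (Level)
open import Function using (_∘_)
open import Data.Nat using (ℕ; _≤_; s≤s)
open import Data.Nat.Properties using (≤-trans; ≤-reflexive; ≤-antisym)
open import Data.Bool using (Bool; true; false; not; T)
import Data.Bool as Bool
open import Data.Bool.Properties using (¬-not; not-¬)
open import Data.Fin using (Fin; _≟_)
open import Data.Fin.Properties using (any?; all?)
open import Data.Fin.Subset
  using (Subset; _∈_; _∉_; _⊆_; _⊂_; _⊃_; _∩_; _∪_; ∁; ⁅_⁆; ⊤; ∣_∣; Nonempty)
open import Data.Fin.Subset.Properties
  using ( _∈?_; _⊆?_; _⊂?_; anySubset?; nonempty?; Empty-unique; ∣⊥∣≡0; ∣⁅x⁆∣≡1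
        ; p⊆q⇒∣p∣≤∣q∣; ⊆-antisym; ∈⊤; ⊆⊤; x∈⁅x⁆; x∈⁅y⁆⇒x≡y
        ; x∈p∩q⁺; p∩q⊆p; p∩q⊆q; x∈p∪q⁺; x∈p∪q⁻; p⊆p∪q; q⊆p∪q; x∈∁p⇒x∉p; x∉p⇒x∈∁p )
open import Data.Fin.Subset.Induction using (Acc; acc; ⊂-wellFounded; ⊃-wellFounded)
open import Data.Vec using (tabulate)
open import Data.Vec.Properties using (≡-dec; lookup∘tabulate; []=⇒lookup; lookup⇒[]=)
open import Data.Product using (∃; ∃₂; _×_; _,_; proj₁; proj₂; ∃-syntax)
open import Data.Sum using (_⊎_; inj₁; inj₂)
open import Data.Empty using (⊥; ⊥-elim)
open import Relation.Nullary using (Dec; yes; no; ¬_; does; contradiction)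
open import Relation.Nullary.Decidable
  using (dec-true; isYes; isYes≗does; decidable-stable; toWitness; ¬?; _×-dec_; _⊎-dec_; _→-dec_)
open import Relation.Unary using (Pred; Decidable)
open import Relation.Binary.PropositionalEquality
  using (_≡_; _≢_; refl; sym; trans; cong; cong₂; subst; module ≡-Reasoning)
open ≡-Reasoning

module _ where
  private variable
    ℓ : Level
    n : ℕ
    p q : Subset n
    x y : Fin n

  _≟ₛ_ : (p q : Subset n) → Dec (p ≡ q)
  _≟ₛ_ = ≡-dec Bool._≟_

  allSubsets? : {P : Pred (Subset n) ℓ} → Decidable P → Dec (∀ p → P p)
  allSubsets? P? with anySubset? (¬? ∘ P?)
  ... | yes (p , ¬Pp) = no λ ∀P → ¬Pp (∀P p)
  ... | no ∄¬P = yes λ p → decidable-stable (P? p) (λ ¬Pp → ∄¬P (p , ¬Pp))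

  ⟦_⟧ : {P : Pred (Fin n) ℓ} → Decidable P → Subset n
  ⟦ P? ⟧ = tabulate (does ∘ P?)

  ∈⟦⟧⁺ : {P : Pred (Fin n) ℓ} (P? : Decidable P) → P x → x ∈ ⟦ P? ⟧
  ∈⟦⟧⁺ {x = x} P? Px =
    lookup⇒[]= x _ (trans (lookup∘tabulate _ x) (dec-true (P? x) Px))

  ∈⟦⟧⁻ : {P : Pred (Fin n) ℓ} (P? : Decidable P) → x ∈ ⟦ P? ⟧ → P x
  ∈⟦⟧⁻ {x = x} P? x∈ =
    toWitness {a? = P? x} (subst T (sym does≡true) _)
    where
    does≡true : isYes (P? x) ≡ true
    does≡true = trans (isYes≗does (P? x)) (trans (sym (lookup∘tabulate _ x)) ([]=⇒lookup x∈))

  ⊆∧⊄⇒⊇ : p ⊆ q → ¬ p ⊂ q → q ⊆ p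
  ⊆∧⊄⇒⊇ {p = p} p⊆q p⊄q {x} x∈q =
    decidable-stable (x ∈? p) λ x∉p → p⊄q (p⊆q , x , x∈q , x∉p)

  ⊈⇒∃∉ : ¬ p ⊆ q → ∃ λ x → x ∈ p × x ∉ q
  ⊈⇒∃∉ {p = p} {q} p⊈q with any? (λ x → x ∈? p ×-dec ¬? (x ∈? q))
  ... | yes found = found
  ... | no ∄ = contradiction (λ {x} x∈p → decidable-stable (x ∈? q) λ x∉q → ∄ (x , x∈p , x∉q)) p⊈q

  ⊆-minimal : {P : Pred (Subset n) ℓ} → Decidable P → P p →
              ∃ λ q → P q × (∀ r → P r → r ⊆ q → q ⊆ r)
  ⊆-minimal {P = P} P? Pp = go (⊂-wellFounded _) Pp
    where
    go : ∀ {p} → Acc _⊂_ p → P p → ∃ λ q → P q × (∀ r → P r → r ⊆ q → q ⊆ r)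
    go {p} (acc below) Pp with anySubset? (λ q → P? q ×-dec q ⊂? p)
    ... | yes (q , Pq , q⊂p) = go (below q⊂p) Pq
    ... | no ∄ = p , Pp , λ r Pr r⊆p → ⊆∧⊄⇒⊇ r⊆p λ r⊂p → ∄ (r , Pr , r⊂p)

  ⊆-maximal : {P : Pred (Subset n) ℓ} → Decidable P → P p →
              ∃ λ q → P q × (∀ r → P r → q ⊆ r → r ⊆ q)
  ⊆-maximal {P = P} P? Pp = go (⊃-wellFounded _) Pp
    where
    go : ∀ {p} → Acc _⊃_ p → P p → ∃ λ q → P q × (∀ r → P r → q ⊆ r → r ⊆ q)
    go {p} (acc above) Pp with anySubset? (λ q → P? q ×-dec p ⊂? q)
    ... | yes (q , Pq , p⊂q) = go (above p⊂q) Pq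
    ... | no ∄ = p , Pp , λ r Pr p⊆r → ⊆∧⊄⇒⊇ p⊆r λ p⊂r → ∄ (r , Pr , p⊂r)

  x∈p⇒⁅x⁆⊆p : x ∈ p → ⁅ x ⁆ ⊆ p
  x∈p⇒⁅x⁆⊆p {x = x} x∈p y∈⁅x⁆ = subst (_∈ _) (sym (x∈⁅y⁆⇒x≡y x y∈⁅x⁆)) x∈p

  x∈p∧y∈p⇒⁅x⁆∪⁅y⁆⊆p : x ∈ p → y ∈ p → ⁅ x ⁆ ∪ ⁅ y ⁆ ⊆ p
  x∈p∧y∈p⇒⁅x⁆∪⁅y⁆⊆p {x = x} {y = y} x∈p y∈p z∈ with x∈p∪q⁻ ⁅ x ⁆ ⁅ y ⁆ z∈
  ... | inj₁ z∈⁅x⁆ = x∈p⇒⁅x⁆⊆p x∈p z∈⁅x⁆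
  ... | inj₂ z∈⁅y⁆ = x∈p⇒⁅x⁆⊆p y∈p z∈⁅y⁆

  y∈p∧y≢x⇒⁅x⁆≢p : y ∈ p → y ≢ x → ⁅ x ⁆ ≢ p
  y∈p∧y≢x⇒⁅x⁆≢p {x = x} y∈p y≢x ⁅x⁆≡p = y≢x (x∈⁅y⁆⇒x≡y x (subst (_ ∈_) (sym ⁅x⁆≡p) y∈p))

  ⁅x⁆≡p∧y∈p⇒⁅y⁆≡p : ⁅ x ⁆ ≡ p → y ∈ p → ⁅ y ⁆ ≡ p
  ⁅x⁆≡p∧y∈p⇒⁅y⁆≡p {x = x} ⁅x⁆≡p y∈p =
    trans (cong ⁅_⁆ (x∈⁅y⁆⇒x≡y x (subst (_ ∈_) (sym ⁅x⁆≡p) y∈p))) ⁅x⁆≡p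

  two-elements : 2 ≤ ∣ p ∣ → ∃₂ λ x y → x ∈ p × y ∈ p × x ≢ y
  two-elements {n} {p} 2≤∣p∣ with nonempty? p
  ... | no ∅ =
    contradiction (≤-trans 2≤∣p∣ (≤-reflexive (trans (cong ∣_∣ (Empty-unique ∅)) (∣⊥∣≡0 n)))) λ ()
  ... | yes (x , x∈p) with any? (λ y → y ∈? p ×-dec ¬? (y ≟ x))
  ...   | yes (y , y∈p , y≢x) = x , y , x∈p , y∈p , y≢x ∘ sym
  ...   | no ∄ =
    contradiction (≤-trans 2≤∣p∣ (≤-trans (p⊆q⇒∣p∣≤∣q∣ p⊆⁅x⁆) (≤-reflexive (∣⁅x⁆∣≡1 x)))) λ { (s≤s ()) }
    where
    p⊆⁅x⁆ : p ⊆ ⁅ x ⁆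
    p⊆⁅x⁆ {y} y∈p =
      subst (_∈ ⁅ x ⁆) (sym (decidable-stable (y ≟ x) λ y≢x → ∄ (y , y∈p , y≢x))) (x∈⁅x⁆ x)

module _ {P Q : ℕ → Set} {k : ℕ} where

  IsGreatest-cong : (∀ {s} → P s → Q s) → (∀ {s} → Q s → P s) → IsGreatest P k → IsGreatest Q k
  IsGreatest-cong P⇒Q Q⇒P (Pk , greatest) = P⇒Q Pk , λ m Qm → greatest m (Q⇒P Qm)

  IsGreatest-transfer : {R : ℕ → Set} → (∀ {s} → Q s → P s) →
                        (∀ {s} → P s → R s → ∃ λ t → Q t × s ≤ t) →
                        IsGreatest P k → R k → IsGreatest Q k
  IsGreatest-transfer Q⇒P P⇒Q (Pk , greatest) Rk with P⇒Q Pk Rk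
  ... | t , Qt , k≤t = subst Q (≤-antisym (greatest t (Q⇒P Qt)) k≤t) Qt , λ m Qm → greatest m (Q⇒P Qm)

module _ {n : ℕ} (G : Graph n) where
  open Graph G

  private variable
    b t : Bool
    a c u v w x y y′ z : Fin n
    A B C D K M N P Q S U W X : Subset n
    k s : ℕ

  -- b = true gives cliques and λ = ■, b = false stable sets and λ = □.
  Monochromatic : Bool → Subset n → Set
  Monochromatic b K = ∀ x y → x ∈ K → y ∈ K → x ≢ y → adj x y ≡ b

  Labelled : Bool → Subset n → Set
  Labelled b M =
    ∀ P Q → IsPart G M P → IsPart G M Q → P ≢ Q → ∀ x y → x ∈ P → y ∈ Q → adj x y ≡ b

  module-uniform : IsModuleIn G M N → x ∈ M → x ∉ N → y ∈ N → y′ ∈ N → adj x y ≡ adj x y′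
  module-uniform (_ , homogeneous) x∈M x∉N y∈N y′∈N with homogeneous _ x∈M x∉N
  ... | inj₁ all  = trans (all _ y∈N) (sym (all _ y′∈N))
  ... | inj₂ none = trans (¬-not (none _ y∈N)) (sym (¬-not (none _ y′∈N)))

  uniform⇒module : N ⊆ M →
                   (∀ {x y y′} → x ∈ M → x ∉ N → y ∈ N → y′ ∈ N → adj x y ≡ adj x y′) →
                   IsModuleIn G M N
  uniform⇒module {N} {M} N⊆M uniform = N⊆M , λ x x∈M x∉N → homogeneous x∈M x∉N (nonempty? N)
    where
    homogeneous : x ∈ M → x ∉ N → Dec (Nonempty N) →
                  (∀ y → y ∈ N → Adj G x y) ⊎ (∀ y → y ∈ N → ¬ Adj G x y)
    homogeneous _ _ (no ∅) = inj₁ λ y y∈N → contradiction (y , y∈N) ∅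
    homogeneous {x} x∈M x∉N (yes (y₀ , y₀∈N)) with adj x y₀ in xy₀
    ... | true  = inj₁ λ y y∈N → trans (uniform x∈M x∉N y∈N y₀∈N) xy₀
    ... | false = inj₂ λ y y∈N → not-¬ (trans (uniform x∈M x∉N y∈N y₀∈N) xy₀)

  module? : ∀ M N → Dec (IsModuleIn G M N)
  module? M N =
    N ⊆? M ×-dec all? λ x → x ∈? M →-dec (¬? (x ∈? N) →-dec
      (all? (λ y → y ∈? N →-dec adj x y Bool.≟ true) ⊎-dec
       all? (λ y → y ∈? N →-dec ¬? (adj x y Bool.≟ true))))

  strongIn? : ∀ M N → Dec (IsStrongIn G M N)
  strongIn? M N = module? M N ×-dec allSubsets? λ N′ →
    module? M N′ →-dec (nonempty? (N ∩ N′) →-dec (N ⊆? N′ ⊎-dec N′ ⊆? N))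

  ⇑? : ∀ W M → Dec (IsUUp G W M)
  ⇑? W M = strongIn? ⊤ M ×-dec W ⊆? M ×-dec ¬? (W ≟ₛ M) ×-dec allSubsets? λ M′ →
    strongIn? ⊤ M′ →-dec (W ⊆? M′ →-dec (¬? (W ≟ₛ M′) →-dec M ⊆? M′))

  module⇒module-in : IsModule G N → N ⊆ M → IsModuleIn G M N
  module⇒module-in (_ , homogeneous) N⊆M = N⊆M , λ x _ → homogeneous x ∈⊤

  module-in-module : IsModuleIn G M N → IsModule G M → IsModule G N
  module-in-module {M} {N} N-mod M-mod = uniform⇒module ⊆⊤ uniform
    where
    uniform : x ∈ ⊤ → x ∉ N → y ∈ N → y′ ∈ N → adj x y ≡ adj x y′
    uniform {x} _ x∉N y∈N y′∈N with x ∈? M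
    ... | yes x∈M = module-uniform N-mod x∈M x∉N y∈N y′∈N
    ... | no x∉M  = module-uniform M-mod ∈⊤ x∉M (proj₁ N-mod y∈N) (proj₁ N-mod y′∈N)

  module-∩ : IsModule G N → IsModuleIn G M (N ∩ M)
  module-∩ {N} {M} N-mod = uniform⇒module (p∩q⊆q N M) λ x∈M x∉N∩M y∈N∩M y′∈N∩M →
    module-uniform N-mod ∈⊤ (λ x∈N → x∉N∩M (x∈p∩q⁺ (x∈N , x∈M)))
                   (p∩q⊆p N M y∈N∩M) (p∩q⊆p N M y′∈N∩M)

  module-∪ : IsModuleIn G M A → IsModuleIn G M B → Nonempty (A ∩ B) → IsModuleIn G M (A ∪ B)
  module-∪ {M} {A} {B} A-mod B-mod (z , z∈A∩B) = uniform⇒module A∪B⊆M λ x∈M x∉A∪B y∈ y′∈ →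
    trans (toward-z x∈M x∉A∪B y∈) (sym (toward-z x∈M x∉A∪B y′∈))
    where
    A∪B⊆M : A ∪ B ⊆ M
    A∪B⊆M y∈A∪B with x∈p∪q⁻ A B y∈A∪B
    ... | inj₁ y∈A = proj₁ A-mod y∈A
    ... | inj₂ y∈B = proj₁ B-mod y∈B
    toward-z : x ∈ M → x ∉ A ∪ B → y ∈ A ∪ B → adj x y ≡ adj x z
    toward-z x∈M x∉A∪B y∈A∪B with x∈p∪q⁻ A B y∈A∪B
    ... | inj₁ y∈A = module-uniform A-mod x∈M (x∉A∪B ∘ x∈p∪q⁺ ∘ inj₁) y∈A (p∩q⊆p A B z∈A∩B)
    ... | inj₂ y∈B = module-uniform B-mod x∈M (x∉A∪B ∘ x∈p∪q⁺ ∘ inj₂) y∈B (p∩q⊆q A B z∈A∩B)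

  monochromatic-module-⊆ : IsModule G K → Monochromatic b K → X ⊆ K → IsModule G X
  monochromatic-module-⊆ {K} {b} {X} K-mod mono X⊆K = uniform⇒module ⊆⊤ uniform
    where
    uniform : x ∈ ⊤ → x ∉ X → y ∈ X → y′ ∈ X → adj x y ≡ adj x y′
    uniform {x} _ x∉X y∈X y′∈X with x ∈? K
    ... | no x∉K  = module-uniform K-mod ∈⊤ x∉K (X⊆K y∈X) (X⊆K y′∈X)
    ... | yes x∈K = trans (coloured y∈X) (sym (coloured y′∈X))
      where
      coloured : y ∈ X → adj x y ≡ b
      coloured y∈X = mono _ _ x∈K (X⊆K y∈X) λ { refl → x∉X y∈X }

  singleton-strong : x ∈ M → IsStrongIn G M ⁅ x ⁆
  singleton-strong {x} x∈M =
    uniform⇒module (x∈p⇒⁅x⁆⊆p x∈M) (λ {_} {y} {y′} _ _ y∈ y′∈ →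
      cong (adj _) (trans (x∈⁅y⁆⇒x≡y x y∈) (sym (x∈⁅y⁆⇒x≡y x y′∈)))) ,
    λ N′ _ (z , z∈) →
      inj₁ (x∈p⇒⁅x⁆⊆p (subst (_∈ N′) (x∈⁅y⁆⇒x≡y x (p∩q⊆p _ N′ z∈)) (p∩q⊆q _ N′ z∈)))

  ⊤-strong : IsStrong G ⊤
  ⊤-strong = (⊆⊤ , λ _ _ x∉⊤ → contradiction ∈⊤ x∉⊤) , λ N′ N′-mod _ → inj₂ (proj₁ N′-mod)

  strong-in-strong : IsStrongIn G M N → IsStrong G M → IsStrong G N
  strong-in-strong {M} {N} (N-mod , N-strong) (M-mod , M-strong) =
    module-in-module N-mod M-mod , nested
    where
    nested : ∀ N′ → IsModule G N′ → Nonempty (N ∩ N′) → N ⊆ N′ ⊎ N′ ⊆ N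
    nested N′ N′-mod (z , z∈N∩N′) =
      via-M (N-strong (N′ ∩ M) (module-∩ N′-mod) (z , x∈p∩q⁺ (z∈N , x∈p∩q⁺ (z∈N′ , z∈M))))
      where
      z∈N = p∩q⊆p N N′ z∈N∩N′
      z∈N′ = p∩q⊆q N N′ z∈N∩N′
      z∈M = proj₁ N-mod z∈N
      via-M : N ⊆ N′ ∩ M ⊎ N′ ∩ M ⊆ N → N ⊆ N′ ⊎ N′ ⊆ N
      via-M (inj₁ N⊆N′∩M) = inj₁ (p∩q⊆p N′ M ∘ N⊆N′∩M)
      via-M (inj₂ N′∩M⊆N) with M-strong N′ N′-mod (z , x∈p∩q⁺ (z∈M , z∈N′))
      ... | inj₁ M⊆N′ = inj₁ (M⊆N′ ∘ proj₁ N-mod)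
      ... | inj₂ N′⊆M = inj₂ λ y∈N′ → N′∩M⊆N (x∈p∩q⁺ (y∈N′ , N′⊆M y∈N′))

  part⊆ : IsPart G M P → P ⊆ M
  part⊆ ((P-mod , _) , _) = proj₁ P-mod

  strong⊆part : IsPart G M P → IsStrongIn G M D → D ≢ M → x ∈ P → x ∈ D → D ⊆ P
  strong⊆part ((_ , P-strong) , _ , _ , P-maximal) D-strong D≢M x∈P x∈D
    with P-strong _ (proj₁ D-strong) (_ , x∈p∩q⁺ (x∈P , x∈D))
  ... | inj₁ P⊆D = P-maximal _ D-strong (_ , x∈D) D≢M P⊆D
  ... | inj₂ D⊆P = D⊆P

  part-unique : IsPart G M P → IsPart G M Q → x ∈ P → x ∈ Q → P ≡ Q
  part-unique P-part@(P-strong , _ , P≢M , _) Q-part@(Q-strong , _ , Q≢M , _) x∈P x∈Q =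
    ⊆-antisym (strong⊆part Q-part P-strong P≢M x∈Q x∈P) (strong⊆part P-part Q-strong Q≢M x∈P x∈Q)

  part-exists : x ∈ M → M ≢ ⁅ x ⁆ → ∃ λ P → IsPart G M P × x ∈ P
  part-exists {x} {M} x∈M M≢⁅x⁆
    with ⊆-maximal (λ X → strongIn? M X ×-dec x ∈? X ×-dec ¬? (X ≟ₛ M))
                   (singleton-strong x∈M , x∈⁅x⁆ x , M≢⁅x⁆ ∘ sym)
  ... | P , (P-strong , x∈P , P≢M) , maximal =
    P , (P-strong , (x , x∈P) , P≢M , λ Q Q-strong _ Q≢M P⊆Q →
           maximal Q (Q-strong , P⊆Q x∈P , Q≢M) P⊆Q) , x∈P

  ⇑-part : IsUUp G ⁅ x ⁆ M → IsPart G M ⁅ x ⁆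
  ⇑-part {x} {M} (M-strong , ⁅x⁆⊆M , ⁅x⁆≢M , least) =
    singleton-strong (⁅x⁆⊆M (x∈⁅x⁆ x)) , (x , x∈⁅x⁆ x) , ⁅x⁆≢M , maximal
    where
    maximal : ∀ Q → IsStrongIn G M Q → Nonempty Q → Q ≢ M → ⁅ x ⁆ ⊆ Q → Q ⊆ ⁅ x ⁆
    maximal Q Q-strong _ Q≢M ⁅x⁆⊆Q with ⁅ x ⁆ ≟ₛ Q
    ... | yes refl = λ y∈Q → y∈Q
    ... | no ⁅x⁆≢Q = contradiction
      (⊆-antisym (proj₁ (proj₁ Q-strong)) (least Q (strong-in-strong Q-strong M-strong) ⁅x⁆⊆Q ⁅x⁆≢Q)) Q≢M

  part-adj-uniform : IsPart G M P → IsPart G M Q → P ≢ Q →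
                     x ∈ P → y ∈ Q → u ∈ P → v ∈ Q → adj x y ≡ adj u v
  part-adj-uniform {x = x} {y} {u} {v} P-part Q-part P≢Q x∈P y∈Q u∈P v∈Q = begin
    adj x y  ≡⟨ module-uniform Q-mod (part⊆ P-part x∈P) (P≢Q ∘ part-unique P-part Q-part x∈P) y∈Q v∈Q ⟩
    adj x v  ≡⟨ adj-sym x v ⟩
    adj v x  ≡⟨ module-uniform P-mod (part⊆ Q-part v∈Q) (P≢Q ∘ sym ∘ part-unique Q-part P-part v∈Q) x∈P u∈P ⟩
    adj v u  ≡⟨ adj-sym v u ⟩
    adj u v  ∎
    where
    P-mod = proj₁ (proj₁ P-part)
    Q-mod = proj₁ (proj₁ Q-part)

  -- All pairs between X and M − X have colour t. So Connected t M says that the graph on M of the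
  -- pairs of colour not t is connected, and IsComponent t M z D that D is the component of z in it.
  Isolated : Bool → Subset n → Subset n → Set
  Isolated t M X = X ⊆ M × ∀ x y → x ∈ X → y ∈ M → y ∉ X → adj x y ≡ t

  isolated? : ∀ t M X → Dec (Isolated t M X)
  isolated? t M X = X ⊆? M ×-dec all? λ x → all? λ y →
    x ∈? X →-dec (y ∈? M →-dec (¬? (y ∈? X) →-dec adj x y Bool.≟ t))

  isolated-trans : Isolated t D X → Isolated t M D → Isolated t M X
  isolated-trans {t} {D} {X} {M} (X⊆D , X-cut) (D⊆M , D-cut) = D⊆M ∘ X⊆D , cut
    where
    cut : ∀ x y → x ∈ X → y ∈ M → y ∉ X → adj x y ≡ t
    cut x y x∈X y∈M y∉X with y ∈? D
    ... | yes y∈D = X-cut x y x∈X y∈D y∉X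
    ... | no y∉D  = D-cut x y (X⊆D x∈X) y∈M y∉D

  isolated-∁ : Isolated t M X → Isolated t M (M ∩ ∁ X)
  isolated-∁ {t} {M} {X} (_ , X-cut) = p∩q⊆p M (∁ X) , λ x y x∈M∖X y∈M y∉M∖X →
    let y∈X = decidable-stable (y ∈? X) λ y∉X → y∉M∖X (x∈p∩q⁺ (y∈M , x∉p⇒x∈∁p y∉X))
    in trans (adj-sym x y)
             (X-cut y x y∈X (p∩q⊆p M (∁ X) x∈M∖X) (x∈∁p⇒x∉p (p∩q⊆q M (∁ X) x∈M∖X)))

  Connected : Bool → Subset n → Set
  Connected t M = ∀ X → Isolated t M X → Nonempty X → M ⊆ X

  IsComponent : Bool → Subset n → Fin n → Subset n → Set
  IsComponent t M z D =
    (Isolated t M D × z ∈ D) × (∀ X → Isolated t M X × z ∈ X → X ⊆ D → D ⊆ X)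

  component-exists : z ∈ M → ∃ (IsComponent t M z)
  component-exists {z} {M} {t} z∈M =
    ⊆-minimal (λ X → isolated? t M X ×-dec z ∈? X)
              (((λ x∈M → x∈M) , λ _ _ _ y∈M y∉M → contradiction y∈M y∉M) , z∈M)

  component-connected : IsComponent t M z D → Connected t D
  component-connected {t} {M} {z} {D} ((D-iso , z∈D) , least) X X-iso (x , x∈X) with z ∈? X
  ... | yes z∈X = least X (isolated-trans X-iso D-iso , z∈X) (proj₁ X-iso)
  ... | no z∉X  = contradiction x∈X (x∈∁p⇒x∉p (p∩q⊆q D (∁ X) (D⊆D∖X (proj₁ X-iso x∈X))))
    where
    D⊆D∖X : D ⊆ D ∩ ∁ X
    D⊆D∖X = least (D ∩ ∁ X) (isolated-trans (isolated-∁ X-iso) D-iso , x∈p∩q⁺ (z∈D , x∉p⇒x∈∁p z∉X))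
                  (p∩q⊆p D (∁ X))

  component-strong : IsComponent t M z D → IsStrongIn G M D
  component-strong {t} {M} {z} {D} component@(((D⊆M , D-cut) , _) , _) = D-mod , nested
    where
    D-mod : IsModuleIn G M D
    D-mod = uniform⇒module D⊆M λ {x} {y} {y′} x∈M x∉D y∈D y′∈D → begin
      adj x y   ≡⟨ adj-sym x y ⟩
      adj y x   ≡⟨ D-cut y x y∈D x∈M x∉D ⟩
      t         ≡⟨ sym (D-cut y′ x y′∈D x∈M x∉D) ⟩
      adj y′ x  ≡⟨ adj-sym y′ x ⟩
      adj x y′  ∎
    nested : ∀ N → IsModuleIn G M N → Nonempty (D ∩ N) → D ⊆ N ⊎ N ⊆ D
    nested N N-mod (a , a∈D∩N) with N ⊆? D
    ... | yes N⊆D = inj₂ N⊆D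
    ... | no N⊈D with ⊈⇒∃∉ N⊈D
    ...   | c , c∈N , c∉D =
      inj₁ (p∩q⊆q D N ∘ component-connected component (D ∩ N) D∩N-iso (a , a∈D∩N))
      where
      D∩N-iso : Isolated t D (D ∩ N)
      D∩N-iso = p∩q⊆p D N , λ x y x∈D∩N y∈D y∉D∩N →
        let y∉N = λ y∈N → y∉D∩N (x∈p∩q⁺ (y∈D , y∈N)) in begin
        adj x y  ≡⟨ adj-sym x y ⟩
        adj y x  ≡⟨ module-uniform N-mod (D⊆M y∈D) y∉N (p∩q⊆q D N x∈D∩N) c∈N ⟩
        adj y c  ≡⟨ D-cut y c y∈D (proj₁ N-mod c∈N) c∉D ⟩
        t        ∎

  connected-both : Connected b M → Connected (not b) M → ∀ t → Connected t M
  connected-both {false} b-conn _ false = b-conn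
  connected-both {false} _ ¬b-conn true = ¬b-conn
  connected-both {true} b-conn _ true = b-conn
  connected-both {true} _ ¬b-conn false = ¬b-conn

  proper-module⊆strong : (∀ t → Connected t M) → IsModuleIn G M A → A ≢ M →
                         ∃ λ N → IsStrongIn G M N × N ≢ M × A ⊆ N
  proper-module⊆strong {M} {A} connected A-mod A≢M
    with ⊆-maximal (λ X → module? M X ×-dec A ⊆? X ×-dec ¬? (X ≟ₛ M)) (A-mod , (λ x∈A → x∈A) , A≢M)
  ... | N , (N-mod , A⊆N , N≢M) , maximal = N , (N-mod , nested) , N≢M , A⊆N
    where
    nested : ∀ N′ → IsModuleIn G M N′ → Nonempty (N ∩ N′) → N ⊆ N′ ⊎ N′ ⊆ N
    nested N′ N′-mod meet with N′ ⊆? N | N ⊆? N′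
    ... | yes N′⊆N | _ = inj₂ N′⊆N
    ... | no _ | yes N⊆N′ = inj₁ N⊆N′
    ... | no N′⊈N | no N⊈N′ with ⊈⇒∃∉ N′⊈N | ⊈⇒∃∉ N⊈N′ | (N ∪ N′) ≟ₛ M
    ...   | c , c∈N′ , c∉N | _ | no N∪N′≢M =
      contradiction (maximal (N ∪ N′) (N∪N′-mod , A⊆N∪N′ , N∪N′≢M) (p⊆p∪q N′) (q⊆p∪q N N′ c∈N′)) c∉N
      where
      N∪N′-mod = module-∪ N-mod N′-mod meet
      A⊆N∪N′ : A ⊆ N ∪ N′
      A⊆N∪N′ = p⊆p∪q N′ ∘ A⊆N
    ...   | c , c∈N′ , c∉N | d , d∈N , d∉N′ | yes N∪N′≡M =
      contradiction c∈N′ (x∈∁p⇒x∉p (p∩q⊆q M (∁ N′) (M⊆M∖N′ c∈M)))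
      where
      -- M − N′ lies in N, so it meets N′ only in pairs of colour adj d c.
      c∈M = proj₁ N′-mod c∈N′
      in-N : x ∈ M → x ∉ N′ → x ∈ N
      in-N x∈M x∉N′ with x∈p∪q⁻ N N′ (subst (_ ∈_) (sym N∪N′≡M) x∈M)
      ... | inj₁ x∈N  = x∈N
      ... | inj₂ x∈N′ = contradiction x∈N′ x∉N′
      M∖N′-iso : Isolated (adj d c) M (M ∩ ∁ N′)
      M∖N′-iso = p∩q⊆p M (∁ N′) , λ x y x∈M∖N′ y∈M y∉M∖N′ →
        let x∈M = p∩q⊆p M (∁ N′) x∈M∖N′
            x∉N′ = x∈∁p⇒x∉p (p∩q⊆q M (∁ N′) x∈M∖N′)
            y∈N′ = decidable-stable (y ∈? N′) λ y∉N′ → y∉M∖N′ (x∈p∩q⁺ (y∈M , x∉p⇒x∈∁p y∉N′))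
        in begin
        adj x y  ≡⟨ module-uniform N′-mod x∈M x∉N′ y∈N′ c∈N′ ⟩
        adj x c  ≡⟨ adj-sym x c ⟩
        adj c x  ≡⟨ module-uniform N-mod c∈M c∉N (in-N x∈M x∉N′) d∈N ⟩
        adj c d  ≡⟨ adj-sym c d ⟩
        adj d c  ∎
      M⊆M∖N′ : M ⊆ M ∩ ∁ N′
      M⊆M∖N′ = connected (adj d c) (M ∩ ∁ N′) M∖N′-iso (d , x∈p∩q⁺ (proj₁ N-mod d∈N , x∉p⇒x∈∁p d∉N′))

  labelled-or-connected : IsPart G M P → IsPart G M Q → P ≢ Q → x ∈ P → y ∈ Q →
                          adj x y ≡ b ⊎ Connected b M
  labelled-or-connected {M} {P} {Q} {x} {y} {b} P-part Q-part P≢Q x∈P y∈Q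
    with component-exists {t = b} (part⊆ P-part x∈P)
  ... | D , component@(((_ , D-cut) , x∈D) , _) with D ≟ₛ M
  ...   | yes refl = inj₂ (component-connected component)
  ...   | no D≢M   = inj₁ (D-cut x y x∈D (part⊆ Q-part y∈Q) y∉D)
    where
    y∉D : y ∉ D
    y∉D y∈D = P≢Q (part-unique P-part Q-part
                     (strong⊆part P-part (component-strong component) D≢M x∈P x∈D y∈D) y∈Q)

  singleton-part-connected : IsPart G M ⁅ v ⁆ → w ∈ M → v ≢ w → adj v w ≡ b →
                             Connected (not b) M
  singleton-part-connected {M} {v} {w} {b} v-part w∈M v≢w vw≡b
    with component-exists {t = not b} (part⊆ v-part (x∈⁅x⁆ v))
  ... | E , component@(((_ , E-cut) , v∈E) , _) with E ≟ₛ M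
  ...   | yes refl = component-connected component
  ...   | no E≢M   = contradiction (E-cut v w v∈E w∈M w∉E) (not-¬ vw≡b)
    where
    w∉E : w ∉ E
    w∉E w∈E = v≢w (sym (x∈⁅y⁆⇒x≡y v
      (strong⊆part v-part (component-strong component) E≢M (x∈⁅x⁆ v) v∈E w∈E)))

  biconnected-no-pair-module : (∀ t → Connected t M) → IsPart G M ⁅ v ⁆ →
                            IsModuleIn G M (⁅ v ⁆ ∪ ⁅ w ⁆) → v ≢ w → ⊥
  biconnected-no-pair-module {M} {v} {w} connected v-part pair-mod v≢w with (⁅ v ⁆ ∪ ⁅ w ⁆) ≟ₛ M
  ... | no pair≢M with proper-module⊆strong connected pair-mod pair≢M
  ...   | N , N-strong , N≢M , pair⊆N = v≢w (sym (x∈⁅y⁆⇒x≡y v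
          (strong⊆part v-part N-strong N≢M (x∈⁅x⁆ v) (pair⊆N (p⊆p∪q ⁅ w ⁆ (x∈⁅x⁆ v)))
                                                      (pair⊆N (q⊆p∪q ⁅ v ⁆ ⁅ w ⁆ (x∈⁅x⁆ w))))))
  biconnected-no-pair-module {M} {v} {w} connected v-part pair-mod v≢w | yes pair≡M =
    v≢w (sym (x∈⁅y⁆⇒x≡y v (connected (adj v w) ⁅ v ⁆ (part⊆ v-part , cut) (v , x∈⁅x⁆ v) w∈M)))
    where
    w∈M = proj₁ pair-mod (q⊆p∪q ⁅ v ⁆ ⁅ w ⁆ (x∈⁅x⁆ w))
    cut : ∀ x y → x ∈ ⁅ v ⁆ → y ∈ M → y ∉ ⁅ v ⁆ → adj x y ≡ adj v w
    cut x y x∈⁅v⁆ y∈M y∉⁅v⁆ with x∈p∪q⁻ ⁅ v ⁆ ⁅ w ⁆ (subst (y ∈_) (sym pair≡M) y∈M)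
    ... | inj₁ y∈⁅v⁆ = contradiction y∈⁅v⁆ y∉⁅v⁆
    ... | inj₂ y∈⁅w⁆ = cong₂ adj (x∈⁅y⁆⇒x≡y v x∈⁅v⁆) (x∈⁅y⁆⇒x≡y w y∈⁅w⁆)

  pair-module⇒labelled : IsPart G M ⁅ v ⁆ → IsModuleIn G M (⁅ v ⁆ ∪ ⁅ w ⁆) → v ≢ w →
                         adj v w ≡ b → Labelled b M
  pair-module⇒labelled {M} {v} {w} {b} v-part pair-mod v≢w vw≡b P Q P-part Q-part P≢Q x y x∈P y∈Q
    with labelled-or-connected {b = b} P-part Q-part P≢Q x∈P y∈Q
  ... | inj₁ xy≡b = xy≡b
  ... | inj₂ b-connected = ⊥-elim (biconnected-no-pair-module
          (connected-both b-connected (singleton-part-connected v-part w∈M v≢w vw≡b)) v-part pair-mod v≢w)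
    where
    w∈M = proj₁ pair-mod (q⊆p∪q ⁅ v ⁆ ⁅ w ⁆ (x∈⁅x⁆ w))

  ⇑-unique : IsUUp G W A → IsUUp G W B → A ≡ B
  ⇑-unique (A-strong , W⊆A , W≢A , A-least) (B-strong , W⊆B , W≢B , B-least) =
    ⊆-antisym (A-least _ B-strong W⊆B W≢B) (B-least _ A-strong W⊆A W≢A)

  ↑-unique : IsUp G W A → IsUp G W B → A ≡ B
  ↑-unique (A-strong , W⊆A , A-least) (B-strong , W⊆B , B-least) =
    ⊆-antisym (A-least _ B-strong W⊆B) (B-least _ A-strong W⊆A)

  ⇑-exists : Nonempty W → W ≢ ⊤ → ∃ (IsUUp G W)
  ⇑-exists {W} (w , w∈W) W≢⊤
    with ⊆-minimal (λ X → strongIn? ⊤ X ×-dec W ⊆? X ×-dec ¬? (W ≟ₛ X)) (⊤-strong , ⊆⊤ , W≢⊤)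
  ... | U , (U-strong , W⊆U , W≢U) , minimal = U , U-strong , W⊆U , W≢U , least
    where
    least : ∀ M → IsStrong G M → W ⊆ M → W ≢ M → U ⊆ M
    least M M-strong W⊆M W≢M with proj₂ U-strong M (proj₁ M-strong) (w , x∈p∩q⁺ (W⊆U w∈W , W⊆M w∈W))
    ... | inj₁ U⊆M = U⊆M
    ... | inj₂ M⊆U = minimal M (M-strong , W⊆M , W≢M) M⊆U

  strong-absorbs-monochromatic : IsModule G K → Monochromatic b K → IsStrong G S →
                                 a ∈ K → a ∈ S → ⁅ a ⁆ ≢ S → K ⊆ S
  strong-absorbs-monochromatic {K} {b} {S} {a} K-mod mono (_ , S-strong) a∈K a∈S ⁅a⁆≢S {u} u∈K
    with S-strong (⁅ a ⁆ ∪ ⁅ u ⁆) (monochromatic-module-⊆ K-mod mono (x∈p∧y∈p⇒⁅x⁆∪⁅y⁆⊆p a∈K u∈K))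
                  (a , x∈p∩q⁺ (a∈S , p⊆p∪q ⁅ u ⁆ (x∈⁅x⁆ a)))
  ... | inj₂ pair⊆S = pair⊆S (q⊆p∪q ⁅ a ⁆ ⁅ u ⁆ (x∈⁅x⁆ u))
  ... | inj₁ S⊆pair = decidable-stable (u ∈? S) λ u∉S → ⁅a⁆≢S (⊆-antisym (x∈p⇒⁅x⁆⊆p a∈S) (S⊆⁅a⁆ u∉S))
    where
    S⊆⁅a⁆ : u ∉ S → S ⊆ ⁅ a ⁆
    S⊆⁅a⁆ u∉S {x} x∈S with x∈p∪q⁻ ⁅ a ⁆ ⁅ u ⁆ (S⊆pair x∈S)
    ... | inj₁ x∈⁅a⁆ = x∈⁅a⁆
    ... | inj₂ x∈⁅u⁆ = contradiction (subst (_∈ S) (x∈⁅y⁆⇒x≡y u x∈⁅u⁆) x∈S) u∉S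

  ⇑-shared : IsModule G K → Monochromatic b K → u ∈ K → v ∈ K → IsUUp G ⁅ v ⁆ U → IsUUp G ⁅ u ⁆ U
  ⇑-shared {K} {b} {u} {v} {U} K-mod mono u∈K v∈K (U-strong , ⁅v⁆⊆U , ⁅v⁆≢U , least) =
    U-strong , x∈p⇒⁅x⁆⊆p (K⊆U u∈K) , (λ ⁅u⁆≡U → ⁅v⁆≢U (⁅x⁆≡p∧y∈p⇒⁅y⁆≡p ⁅u⁆≡U (K⊆U v∈K))) , least′
    where
    K⊆U = strong-absorbs-monochromatic K-mod mono U-strong v∈K (⁅v⁆⊆U (x∈⁅x⁆ v)) ⁅v⁆≢U
    least′ : ∀ M → IsStrong G M → ⁅ u ⁆ ⊆ M → ⁅ u ⁆ ≢ M → U ⊆ M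
    least′ M M-strong ⁅u⁆⊆M ⁅u⁆≢M =
      least M M-strong (x∈p⇒⁅x⁆⊆p (K⊆M v∈K)) λ ⁅v⁆≡M → ⁅u⁆≢M (⁅x⁆≡p∧y∈p⇒⁅y⁆≡p ⁅v⁆≡M (K⊆M u∈K))
      where
      K⊆M = strong-absorbs-monochromatic K-mod mono M-strong u∈K (⁅u⁆⊆M (x∈⁅x⁆ u)) ⁅u⁆≢M

  ⇑-fibre : Subset n → Subset n
  ⇑-fibre U = ⟦ (λ u → ⇑? ⁅ u ⁆ U) ⟧

  ⇑-fibre-class : IsUUp G ⁅ v ⁆ U → IsClass G (⇑-fibre U)
  ⇑-fibre-class {v} {U} v⇑ = v , ∈⟦⟧⁺ (λ u → ⇑? ⁅ u ⁆ U) v⇑ , λ u →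
    (λ u∈C → U , v⇑ , ∈⟦⟧⁻ (λ u → ⇑? ⁅ u ⁆ U) u∈C) ,
    λ { (U′ , v⇑′ , u⇑′) → ∈⟦⟧⁺ (λ u → ⇑? ⁅ u ⁆ U) (subst (IsUUp G ⁅ u ⁆) (⇑-unique v⇑′ v⇑) u⇑′) }

  class-⇑ : IsClass G C → ∃ λ U → ∀ {c} → c ∈ C → IsUUp G ⁅ c ⁆ U
  class-⇑ (v , v∈C , equivalent) with proj₁ (equivalent v) v∈C
  ... | U , v⇑ , _ = U , λ {c} c∈C → shared (proj₁ (equivalent c) c∈C)
    where
    shared : Equiv G v c → IsUUp G ⁅ c ⁆ U
    shared (U′ , v⇑′ , c⇑′) = subst (IsUUp G ⁅ _ ⁆) (⇑-unique v⇑′ v⇑) c⇑′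

  shared-⇑-↑ : (∀ {c} → c ∈ C → IsUUp G ⁅ c ⁆ U) → v ∈ C → w ∈ C → v ≢ w → IsUp G C U
  shared-⇑-↑ {C} {U} {v} {w} C⇑ v∈C w∈C v≢w with C⇑ v∈C
  ... | U-strong , _ , _ , least =
    U-strong , (λ {c} c∈C → proj₁ (proj₂ (C⇑ c∈C)) (x∈⁅x⁆ c)) ,
    λ M M-strong C⊆M → least M M-strong (x∈p⇒⁅x⁆⊆p (C⊆M v∈C)) (y∈p∧y≢x⇒⁅x⁆≢p (C⊆M w∈C) (v≢w ∘ sym))

  singleton-parts⇒monochromatic : (∀ {c} → c ∈ C → IsPart G M ⁅ c ⁆) → Labelled b M →
                                  Monochromatic b C
  singleton-parts⇒monochromatic parts labelled x y x∈C y∈C x≢y =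
    labelled ⁅ x ⁆ ⁅ y ⁆ (parts x∈C) (parts y∈C) (y∈p∧y≢x⇒⁅x⁆≢p (x∈⁅x⁆ y) (x≢y ∘ sym))
             x y (x∈⁅x⁆ x) (x∈⁅x⁆ y)

  singleton-parts⇒module : IsModule G M → (∀ {c} → c ∈ C → IsPart G M ⁅ c ⁆) → Labelled b M →
                           IsModule G C
  singleton-parts⇒module {M} {C} {b} M-mod parts labelled = uniform⇒module ⊆⊤ uniform
    where
    C⊆M : C ⊆ M
    C⊆M {c} c∈C = part⊆ (parts c∈C) (x∈⁅x⁆ c)
    uniform : x ∈ ⊤ → x ∉ C → y ∈ C → y′ ∈ C → adj x y ≡ adj x y′
    uniform {x} {y} _ x∉C y∈C y′∈C with x ∈? M
    ... | no x∉M = module-uniform M-mod ∈⊤ x∉M (C⊆M y∈C) (C⊆M y′∈C)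
    ... | yes x∈M with part-exists x∈M (y∈p∧y≢x⇒⁅x⁆≢p (C⊆M y∈C) (λ { refl → x∉C y∈C }) ∘ sym)
    ...   | P , P-part , x∈P = trans (coloured y∈C) (sym (coloured y′∈C))
      where
      coloured : ∀ {c} → c ∈ C → adj x c ≡ b
      coloured {c} c∈C = labelled P ⁅ c ⁆ P-part (parts c∈C) P≢⁅c⁆ x c x∈P (x∈⁅x⁆ c)
        where
        P≢⁅c⁆ : P ≢ ⁅ c ⁆
        P≢⁅c⁆ P≡⁅c⁆ = x∉C (subst (_∈ C) (sym (x∈⁅y⁆⇒x≡y c (subst (x ∈_) P≡⁅c⁆ x∈P))) c∈C)

  class⇒monochromatic-module : IsClass G C → 2 ≤ ∣ C ∣ → IsUp G C M → Labelled b M →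
                               IsModule G C × Monochromatic b C
  class⇒monochromatic-module {C} {M} class 2≤∣C∣ C↑M labelled with class-⇑ class | two-elements 2≤∣C∣
  ... | U , C⇑ | v , w , v∈C , w∈C , v≢w =
    singleton-parts⇒module (proj₁ (proj₁ C↑M)) parts labelled ,
    singleton-parts⇒monochromatic parts labelled
    where
    parts : ∀ {c} → c ∈ C → IsPart G M ⁅ c ⁆
    parts c∈C = subst (λ M → IsPart G M ⁅ _ ⁆) (↑-unique (shared-⇑-↑ C⇑ v∈C w∈C v≢w) C↑M) (⇑-part (C⇑ c∈C))

  monochromatic-module⇒class : IsModule G K → Monochromatic b K → 2 ≤ ∣ K ∣ →
                               ∃ λ C → IsClass G C × (∃ λ U → IsUp G C U × Labelled b U) × K ⊆ C
  monochromatic-module⇒class {K} {b} K-mod mono 2≤∣K∣ with two-elements 2≤∣K∣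
  ... | v , w , v∈K , w∈K , v≢w with ⇑-exists (v , x∈⁅x⁆ v) (y∈p∧y≢x⇒⁅x⁆≢p ∈⊤ (v≢w ∘ sym))
  ...   | U , v⇑ = ⇑-fibre U , ⇑-fibre-class v⇑ , (U , C↑U , labelled) , K⊆C
    where
    K⊆C : K ⊆ ⇑-fibre U
    K⊆C u∈K = ∈⟦⟧⁺ (λ u → ⇑? ⁅ u ⁆ U) (⇑-shared K-mod mono u∈K v∈K v⇑)
    C↑U : IsUp G (⇑-fibre U) U
    C↑U = shared-⇑-↑ (∈⟦⟧⁻ (λ u → ⇑? ⁅ u ⁆ U)) (K⊆C v∈K) (K⊆C w∈K) v≢w
    K⊆U : K ⊆ U
    K⊆U = proj₁ (proj₂ C↑U) ∘ K⊆C
    labelled : Labelled b U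
    labelled = pair-module⇒labelled (⇑-part v⇑)
      (module⇒module-in (monochromatic-module-⊆ K-mod mono (x∈p∧y∈p⇒⁅x⁆∪⁅y⁆⊆p v∈K w∈K))
                        (x∈p∧y∈p⇒⁅x⁆∪⁅y⁆⊆p (K⊆U v∈K) (K⊆U w∈K)))
      v≢w (mono v w v∈K w∈K v≢w)

  labelled⇒complete : Labelled true M → LabelComplete G M
  labelled⇒complete labelled P Q P-part@(_ , (x , x∈P) , _) Q-part@(_ , (y , y∈Q) , _) P≢Q =
    x , y , x∈P , y∈Q , labelled P Q P-part Q-part P≢Q x y x∈P y∈Q

  complete⇒labelled : LabelComplete G M → Labelled true M
  complete⇒labelled complete P Q P-part Q-part P≢Q x y x∈P y∈Q with complete P Q P-part Q-part P≢Q
  ... | u , v , u∈P , v∈Q , uv = trans (part-adj-uniform P-part Q-part P≢Q x∈P y∈Q u∈P v∈Q) uv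

  labelled⇒empty : Labelled false M → LabelEmpty G M
  labelled⇒empty labelled P Q P-part Q-part P≢Q (x , y , x∈P , y∈Q , xy) =
    not-¬ (labelled P Q P-part Q-part P≢Q x y x∈P y∈Q) xy

  empty⇒labelled : LabelEmpty G M → Labelled false M
  empty⇒labelled empty P Q P-part Q-part P≢Q x y x∈P y∈Q =
    ¬-not λ xy → empty P Q P-part Q-part P≢Q (x , y , x∈P , y∈Q , xy)

  stable⇒monochromatic : IsStable G K → Monochromatic false K
  stable⇒monochromatic stable x y x∈K y∈K x≢y = ¬-not (stable x y x∈K y∈K x≢y)

  monochromatic⇒stable : Monochromatic false K → IsStable G K
  monochromatic⇒stable mono x y x∈K y∈K x≢y = not-¬ (mono x y x∈K y∈K x≢y)

  ModuleSizes : (Subset n → Set) → ℕ → Set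
  ModuleSizes Kind s = ∃[ M ] (IsModule G M × Kind M × ∣ M ∣ ≡ s)

  ClassSizes : (Subset n → Set) → ℕ → Set
  ClassSizes Label s = ∃[ C ] (IsClass G C × 2 ≤ ∣ C ∣ × (∃[ M ] (IsUp G C M × Label M)) × ∣ C ∣ ≡ s)

  ModuleSizes-map : {L L′ : Subset n → Set} → (∀ {M} → L M → L′ M) → ModuleSizes L s → ModuleSizes L′ s
  ModuleSizes-map L⇒L′ (M , M-mod , LM , ∣M∣≡s) = M , M-mod , L⇒L′ LM , ∣M∣≡s

  ClassSizes-map : {L L′ : Subset n → Set} → (∀ {M} → L M → L′ M) → ClassSizes L s → ClassSizes L′ s
  ClassSizes-map L⇒L′ (C , class , 2≤∣C∣ , (M , C↑M , LM) , ∣C∣≡s) =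
    C , class , 2≤∣C∣ , (M , C↑M , L⇒L′ LM) , ∣C∣≡s

  class-size⇒module-size : ClassSizes (Labelled b) s → ModuleSizes (Monochromatic b) s
  class-size⇒module-size (C , class , 2≤∣C∣ , (M , C↑M , labelled) , ∣C∣≡s)
    with class⇒monochromatic-module class 2≤∣C∣ C↑M labelled
  ... | C-mod , mono = C , C-mod , mono , ∣C∣≡s

  module-size⇒class-size : ModuleSizes (Monochromatic b) s → 2 ≤ s →
                           ∃ λ s′ → ClassSizes (Labelled b) s′ × s ≤ s′
  module-size⇒class-size {b} (K , K-mod , mono , refl) 2≤∣K∣ =
    enlarge (monochromatic-module⇒class K-mod mono 2≤∣K∣)
    where
    enlarge : (∃ λ C → IsClass G C × (∃ λ U → IsUp G C U × Labelled b U) × K ⊆ C) →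
              ∃ λ s′ → ClassSizes (Labelled b) s′ × ∣ K ∣ ≤ s′
    enlarge (C , class , C↑ , K⊆C) = ∣ C ∣ , (C , class , ≤-trans 2≤∣K∣ ∣K∣≤∣C∣ , C↑ , refl) , ∣K∣≤∣C∣
      where
      ∣K∣≤∣C∣ : ∣ K ∣ ≤ ∣ C ∣
      ∣K∣≤∣C∣ = p⊆q⇒∣p∣≤∣q∣ K⊆C

  greatest-class-size : IsGreatest (ModuleSizes (Monochromatic b)) k → 2 ≤ k →
                        IsGreatest (ClassSizes (Labelled b)) k
  greatest-class-size = IsGreatest-transfer class-size⇒module-size module-size⇒class-size

corollary17 : ∀ {n : ℕ} (G : Graph n) → 2 ≤ n →
    (∀ k → IsOmegaM G k → 2 ≤ k →
    IsGreatest (λ s → ∃[ C ] (IsClass G C × 2 ≤ ∣ C ∣ ×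
    (∃[ M ] (IsUp G C M × LabelComplete G M)) × ∣ C ∣ ≡ s)) k)
    × (∀ k → IsAlphaM G k → 2 ≤ k →
    IsGreatest (λ s → ∃[ C ] (IsClass G C × 2 ≤ ∣ C ∣ ×
    (∃[ M ] (IsUp G C M × LabelEmpty G M)) × ∣ C ∣ ≡ s)) k)
-- The hypothesis 2 ≤ n is implied by 2 ≤ k.
corollary17 G _ = ω-case , α-case
  where
  ω-case : ∀ k → IsOmegaM G k → 2 ≤ k → IsGreatest (ClassSizes G (LabelComplete G)) k
  ω-case k ω 2≤k =
    IsGreatest-cong (ClassSizes-map G (labelled⇒complete G)) (ClassSizes-map G (complete⇒labelled G))
      (greatest-class-size G ω 2≤k)
  α-case : ∀ k → IsAlphaM G k → 2 ≤ k → IsGreatest (ClassSizes G (LabelEmpty G)) k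
  α-case k α 2≤k =
    IsGreatest-cong (ClassSizes-map G (labelled⇒empty G)) (ClassSizes-map G (empty⇒labelled G))
      (greatest-class-size G
        (IsGreatest-cong (ModuleSizes-map G (stable⇒monochromatic G))
                         (ModuleSizes-map G (monochromatic⇒stable G)) α)
        2≤k)
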